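{- Let $\mathcal{C}$ be an $\mathcal{O}(\sqrt{m})$-separable graph class, and let $G\in\mathcal{C}$ be a graph with $n$ vertices and maximum degree $\Delta$. Then $G$ has treewidth at most $\mathcal{O}(\sqrt{n\Delta})$.
   Context: A graph class $\mathcal{C}$ is $\mathcal{O}(\sqrt{m})$-separable if it is hereditary (closed under induced subgraphs) and there is a constant $c$ such that every $G\in\mathcal{C}$ has a balanced separator with at most $c\sqrt{|E(G)|}$ vertices, where $S\subseteq V(G)$ is a balanced separator if every connected component of $G\setminus S$ has at most $\frac{2}{3}|V(G)|$ vertices. The constant in $\mathcal{O}(\sqrt{n\Delta})$ depends only on $\mathcal{C}$. -}

module Defs where

open import Data.Nat using (ℕ; zero; suc; _+_; _*_; _≤_; _⊔_; _<ᵇ_)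
open import Data.Bool using (Bool; true; false; if_then_else_; _∧_)
open import Data.Fin using (Fin; zero; suc; toℕ; inject₁; fromℕ)
open import Data.Fin.Subset using (Subset; _∈_; _∉_; ∣_∣)
open import Data.List using (List; map; foldr)
open import Data.Nat.ListAction using (sum)
open import Data.List.Base using (allFin)
open import Data.Product using (Σ; ∃; _×_; _,_)
open import Data.Unit using (⊤)
open import Relation.Nullary using (¬_)
open import Relation.Binary.PropositionalEquality using (_≡_)
open import Function.Definitions using (Injective)

record Graph : Set where
  field
    n      : ℕ
    adj    : Fin n → Fin n → Bool
    sym    : ∀ i j → adj i j ≡ adj j i
    irrefl : ∀ i → adj i i ≡ false
open Graph public

degree : (G : Graph) → Fin (n G) → ℕ
degree G v = sum (map (λ u → if adj G v u then 1 else 0) (allFin (n G)))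

maxDeg : Graph → ℕ
maxDeg G = foldr _⊔_ 0 (map (degree G) (allFin (n G)))

edgeCount : Graph → ℕ
edgeCount G = sum (map (λ i → sum (map (λ j → if (toℕ i <ᵇ toℕ j) ∧ adj G i j then 1 else 0)
                                       (allFin (n G))))
                       (allFin (n G)))

data PWalk (G : Graph) (P : Fin (n G) → Set) : Fin (n G) → Fin (n G) → Set where
  here : ∀ {v} → P v → PWalk G P v v
  step : ∀ {u w v} → P u → adj G u w ≡ true → PWalk G P w v → PWalk G P u v

InducedSubgraph : Graph → Graph → Set
InducedSubgraph H G =
  Σ (Fin (n H) → Fin (n G)) λ f →
    Injective _≡_ _≡_ f × (∀ i j → adj H i j ≡ adj G (f i) (f j))

GraphClass : Set₁
GraphClass = Graph → Set

Hereditary : GraphClass → Set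
Hereditary 𝒞 = ∀ G H → 𝒞 G → InducedSubgraph H G → 𝒞 H

-- A component is given as the subset C of vertices
-- reachable from some v ∉ S by a walk avoiding S.
Balanced : (G : Graph) → Subset (n G) → Set
Balanced G S =
  ∀ (v : Fin (n G)) → v ∉ S → (C : Subset (n G)) →
    (∀ u → (u ∈ C → PWalk G (λ x → x ∉ S) v u) × (PWalk G (λ x → x ∉ S) v u → u ∈ C)) →
    3 * ∣ C ∣ ≤ 2 * n G

-- O(√m)-separable: hereditary, and ∃ c, every G ∈ 𝒞 has a balanced separator S
-- with |S| ≤ c·√(m+1), i.e. |S|² ≤ c'·(m+1).
SqrtMSeparable : GraphClass → Set
SqrtMSeparable 𝒞 =
  Hereditary 𝒞 ×
  ∃ λ (c : ℕ) → ∀ G → 𝒞 G →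
    ∃ λ (S : Subset (n G)) → Balanced G S × (∣ S ∣ * ∣ S ∣ ≤ c * (edgeCount G + 1))

Connected : Graph → Set
Connected T = ∀ u v → PWalk T (λ _ → ⊤) u v

-- a cycle of length k+3: injective map c with consecutive vertices adjacent
HasCycle : Graph → Set
HasCycle T =
  Σ ℕ λ k → Σ (Fin (3 + k) → Fin (n T)) λ c →
    Injective _≡_ _≡_ c ×
    (∀ (i : Fin (2 + k)) → adj T (c (inject₁ i)) (c (suc i)) ≡ true) ×
    (adj T (c (fromℕ (2 + k))) (c zero) ≡ true)

IsTree : Graph → Set
IsTree T = (1 ≤ n T) × Connected T × ¬ HasCycle T

record TreeDecomposition (G : Graph) (w : ℕ) : Set where
  field
    T      : Graph
    isTree : IsTree T
    bag    : Fin (n T) → Subset (n G)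
    vertexCover : ∀ v → ∃ λ t → v ∈ bag t
    edgeCover   : ∀ u v → adj G u v ≡ true → ∃ λ t → (u ∈ bag t) × (v ∈ bag t)
    coherent    : ∀ v t₁ t₂ → v ∈ bag t₁ → v ∈ bag t₂ → PWalk T (λ t → v ∈ bag t) t₁ t₂
    width       : ∀ t → ∣ bag t ∣ ≤ suc w

TreewidthAtMost : Graph → ℕ → Set
TreewidthAtMost G w = TreeDecomposition G w

module Submission where

-- A set U of k vertices spans at most k Δ edges, so the subgraph it induces, which lies in
-- 𝒞 by heredity, has a balanced separator S of size O(√(k Δ)). Adding S to every bag of
-- path decompositions of the components of U ∖ S, each of at most 2k/3 vertices, gives
-- bags of size β(k) ≤ |S| + β(2k/3); this geometric recursion sums to O(√(n Δ)), and a
-- path decomposition is a tree decomposition along a path. Edgeless graphs, where the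
-- bound is 0, get singleton bags instead.

open import Data.Bool using (Bool; true; false; if_then_else_; _∧_)
import Data.Bool as Bool
open import Data.Empty using (⊥; ⊥-elim)
open import Data.Fin using (Fin; zero; suc; toℕ; inject₁; fromℕ)
open import Data.Fin.Properties using (toℕ-injective; any?) renaming (suc-injective to Fin-suc-injective)
open import Data.Fin.Subset
  using (Subset; _∈_; _∉_; ∣_∣; _⊆_; _∪_; _─_; inside; outside; Nonempty; ⁅_⁆)
  renaming (⊤ to Full; ⊥ to Empty)
open import Data.Fin.Subset.Properties
  using (∈⊤; ∉⊥; ∣⊥∣≡0; _∈?_; x∈p∪q⁻; x∈p∪q⁺; nonempty?; p⊆q⇒∣p∣≤∣q∣; ∣p∣≤n; p⊂q⇒∣p∣<∣q∣;
         p∩q≢∅⇒∣p─q∣<∣p∣; x∈p∩q⁺; x∈⁅x⁆; x∈⁅y⁆⇒x≡y; ∣⁅x⁆∣≡1; x∈p∧x∉q⇒x∈p─q; p─q⊆p; drop-∷-⊆)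
open import Data.List using (List; []; _∷_; length; _++_; lookup; map; foldr; allFin)
open import Data.List.Membership.Propositional using () renaming (_∈_ to _∈ₗ_)
open import Data.List.Membership.Propositional.Properties using (∈-lookup; ∈-map⁺; ∈-allFin)
open import Data.List.Properties using (map-tabulate)
open import Data.List.Relation.Unary.All as All using (All; []; _∷_)
import Data.List.Relation.Unary.All.Properties as All
open import Data.List.Relation.Unary.Any as Any using (Any)
import Data.List.Relation.Unary.Any.Properties as Any
open import Data.Nat
open import Data.Nat.DivMod using (_/_; m/n*n≤m; m<n*o⇒m/o<n; /-monoˡ-≤; m*n/n≡m)
open import Data.Nat.Induction using (<-rec)
open import Data.Nat.ListAction using (sum)
open import Data.Nat.Properties
open import Data.Nat.Tactic.RingSolver using (solve-∀)
open import Data.Product using (Σ; ∃; _×_; _,_; proj₁; proj₂)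
open import Data.Sum using (_⊎_; inj₁; inj₂; [_,_]′)
open import Data.Unit using (⊤; tt)
open import Data.Vec.Base using ([]; _∷_; here; there)
import Data.Vec.Base as Vec
open import Data.Vec.Properties using ([]=⇒lookup; lookup⇒[]=; lookup∘tabulate)
open import Function using (_∘_; id)
open import Relation.Binary.PropositionalEquality
open import Relation.Nullary using (¬_; Dec; yes; no; does)
open import Relation.Nullary.Decidable using (_×-dec_; _⊎-dec_; ¬?)
open import Relation.Unary using (Decidable)

open import Defs hiding (sym)

walk-++ : ∀ {G P a b c} → PWalk G P a b → PWalk G P b c → PWalk G P a c
walk-++ (here _)      w = w
walk-++ (step p e w₁) w = step p e (walk-++ w₁ w)

walk-map : ∀ {G P Q a b} → (∀ x → P x → Q x) → PWalk G P a b → PWalk G Q a b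
walk-map f (here p)     = here (f _ p)
walk-map f (step p e w) = step (f _ p) e (walk-map f w)

walk-head : ∀ {G P a b} → PWalk G P a b → P a
walk-head (here p)     = p
walk-head (step p _ _) = p

walk-last : ∀ {G P a b} → PWalk G P a b → P b
walk-last (here p)     = p
walk-last (step _ _ w) = walk-last w

Consecutive : ℕ → ℕ → Set
Consecutive x y = suc x ≡ y ⊎ suc y ≡ x

-- A sequence moving by unit steps and injective on its first k + 3 terms is monotone:
-- a step cannot be undone, since f (m + 2) ≡ f m would contradict injectivity.
module UnitStepSequence (f : ℕ → ℕ) (k : ℕ)
  (consecutive : ∀ m → suc m < 3 + k → Consecutive (f m) (f (suc m)))
  (injective : ∀ {m m′} → m < 3 + k → m′ < 3 + k → f m ≡ f m′ → m ≡ m′) where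

  private
    no-backtrack : ∀ {m} → suc (suc m) < 3 + k → f (suc (suc m)) ≢ f m
    no-backtrack {m} lt e =
      >⇒≢ (m<n⇒m<1+n (n<1+n m)) (injective lt (<-trans (m<n⇒m<1+n (n<1+n m)) lt) e)

  rising : suc (f 0) ≡ f 1 → ∀ m → suc m < 3 + k → suc (f m) ≡ f (suc m)
  rising up zero    _  = up
  rising up (suc m) lt with consecutive (suc m) lt
  ... | inj₁ e = e
  ... | inj₂ e = ⊥-elim (no-backtrack lt (suc-injective (trans e (sym (rising up m (<-trans (n<1+n _) lt))))))

  falling : suc (f 1) ≡ f 0 → ∀ m → suc m < 3 + k → suc (f (suc m)) ≡ f m
  falling down zero    _  = down
  falling down (suc m) lt with consecutive (suc m) lt
  ... | inj₂ e = e
  ... | inj₁ e = ⊥-elim (no-backtrack lt (trans (sym e) (falling down m (<-trans (n<1+n _) lt))))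

  rising-value : suc (f 0) ≡ f 1 → ∀ m → m < 3 + k → f m ≡ f 0 + m
  rising-value up zero    _  = sym (+-identityʳ (f 0))
  rising-value up (suc m) lt = begin
    f (suc m)      ≡⟨ rising up m lt ⟨
    suc (f m)      ≡⟨ cong suc (rising-value up m (<-trans (n<1+n m) lt)) ⟩
    suc (f 0 + m)  ≡⟨ +-suc (f 0) m ⟨
    f 0 + suc m    ∎
    where open ≡-Reasoning

  falling-value : suc (f 1) ≡ f 0 → ∀ m → m < 3 + k → f m + m ≡ f 0
  falling-value down zero    _  = +-identityʳ (f 0)
  falling-value down (suc m) lt = begin
    f (suc m) + suc m    ≡⟨ +-suc (f (suc m)) m ⟩
    suc (f (suc m)) + m  ≡⟨ cong (_+ m) (falling down m lt) ⟩
    f m + m              ≡⟨ falling-value down m (<-trans (n<1+n m) lt) ⟩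
    f 0                  ∎
    where open ≡-Reasoning

  ends-not-consecutive : ¬ Consecutive (f (2 + k)) (f 0)
  ends-not-consecutive ends with consecutive 0 (s≤s (s≤s z≤n)) | ends
  ... | inj₁ up | inj₁ e =
    m≢1+m+n (f 0) (trans (sym e) (cong suc (rising-value up (2 + k) ≤-refl)))
  ... | inj₁ up | inj₂ e with +-cancelˡ-≡ (f 0) 1 (2 + k)
                                (trans (+-comm (f 0) 1) (trans e (rising-value up (2 + k) ≤-refl)))
  ...   | ()
  ends-not-consecutive ends | inj₂ down | inj₂ e =
    m+1+n≢m (f 0) (trans (+-suc (f 0) (2 + k)) (trans (cong (_+ (2 + k)) e) (falling-value down (2 + k) ≤-refl)))
  ends-not-consecutive ends | inj₂ down | inj₁ e with +-cancelˡ-≡ (f (2 + k)) (2 + k) 1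
    (trans (falling-value down (2 + k) ≤-refl) (trans (sym e) (+-comm 1 (f (2 + k)))))
  ...   | ()

pathAdj : ∀ {m} → Fin m → Fin m → Bool
pathAdj (suc i)    (suc j)    = pathAdj i j
pathAdj zero       (suc zero) = true
pathAdj (suc zero) zero       = true
pathAdj _          _          = false

pathAdj-sym : ∀ {m} (i j : Fin m) → pathAdj i j ≡ pathAdj j i
pathAdj-sym zero          zero          = refl
pathAdj-sym zero          (suc zero)    = refl
pathAdj-sym zero          (suc (suc j)) = refl
pathAdj-sym (suc zero)    zero          = refl
pathAdj-sym (suc (suc i)) zero          = refl
pathAdj-sym (suc i)       (suc j)       = pathAdj-sym i j

pathAdj-irrefl : ∀ {m} (i : Fin m) → pathAdj i i ≡ false
pathAdj-irrefl zero    = refl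
pathAdj-irrefl (suc i) = pathAdj-irrefl i

pathAdj⇒consecutive : ∀ {m} (i j : Fin m) → pathAdj i j ≡ true → Consecutive (toℕ i) (toℕ j)
pathAdj⇒consecutive zero       (suc zero) _ = inj₁ refl
pathAdj⇒consecutive (suc zero) zero       _ = inj₂ refl
pathAdj⇒consecutive (suc i)    (suc j)    e with pathAdj⇒consecutive i j e
... | inj₁ up   = inj₁ (cong suc up)
... | inj₂ down = inj₂ (cong suc down)

Path : ℕ → Graph
Path m = record { n = m ; adj = pathAdj ; sym = pathAdj-sym ; irrefl = pathAdj-irrefl }

walk-suc : ∀ {m} {P : Fin m → Set} {Q : Fin (suc m) → Set} → (∀ t → P t → Q (suc t)) →
           ∀ {i j} → PWalk (Path m) P i j → PWalk (Path (suc m)) Q (suc i) (suc j)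
walk-suc f (here p)     = here (f _ p)
walk-suc f (step p e w) = step (f _ p) e (walk-suc f w)

Path-connected-to-zero : ∀ {m} (i : Fin (suc m)) →
  PWalk (Path (suc m)) (λ _ → ⊤) zero i × PWalk (Path (suc m)) (λ _ → ⊤) i zero
Path-connected-to-zero zero = here tt , here tt
Path-connected-to-zero {suc m} (suc i) with Path-connected-to-zero i
... | to , back = step tt refl (walk-suc _ to) , walk-++ (walk-suc _ back) (step tt refl (here tt))

Path-connected : ∀ m → Connected (Path (suc m))
Path-connected m u v = walk-++ (proj₂ (Path-connected-to-zero u)) (proj₁ (Path-connected-to-zero v))

clamp : ∀ {N} → ℕ → Fin (suc N)
clamp zero          = zero
clamp {zero}  (suc m) = zero
clamp {suc N} (suc m) = suc (clamp {N} m)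

inject₁-clamp : ∀ {N} m → m < suc N → inject₁ (clamp {N} m) ≡ clamp {suc N} m
inject₁-clamp zero            _        = refl
inject₁-clamp {suc N} (suc m) (s≤s lt) = cong suc (inject₁-clamp m lt)

toℕ-clamp : ∀ {N} m → m < suc N → toℕ (clamp {N} m) ≡ m
toℕ-clamp zero            _        = refl
toℕ-clamp {suc N} (suc m) (s≤s lt) = cong suc (toℕ-clamp m lt)

clamp-fromℕ : ∀ N → clamp {N} N ≡ fromℕ N
clamp-fromℕ zero    = refl
clamp-fromℕ (suc N) = cong suc (clamp-fromℕ N)

-- Read along the cycle, the positions of its vertices on the path form a unit-step
-- injective sequence whose two ends would have to be consecutive.
Path-acyclic : ∀ m → ¬ HasCycle (Path m)
Path-acyclic m (k , cyc , cyc-injective , cyc-adj , cyc-closing) =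
  UnitStepSequence.ends-not-consecutive f k consecutive injective closing
  where
  f : ℕ → ℕ
  f i = toℕ (cyc (clamp i))
  consecutive : ∀ i → suc i < 3 + k → Consecutive (f i) (f (suc i))
  consecutive i (s≤s lt) = subst (λ x → Consecutive (toℕ (cyc x)) (f (suc i))) (inject₁-clamp i lt)
    (pathAdj⇒consecutive _ _ (cyc-adj (clamp i)))
  injective : ∀ {i j} → i < 3 + k → j < 3 + k → f i ≡ f j → i ≡ j
  injective {i} {j} i< j< e =
    trans (sym (toℕ-clamp i i<)) (trans (cong toℕ (cyc-injective (toℕ-injective e))) (toℕ-clamp j j<))
  closing : Consecutive (f (2 + k)) (f 0)
  closing = subst (λ x → Consecutive (toℕ (cyc x)) (f 0)) (sym (clamp-fromℕ (2 + k)))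
    (pathAdj⇒consecutive _ _ cyc-closing)

Path-isTree : ∀ m → IsTree (Path (suc m))
Path-isTree m = s≤s z≤n , Path-connected m , Path-acyclic (suc m)

x∈p─q⇒x∉q : ∀ {m} {x : Fin m} (p q : Subset m) → x ∈ p ─ q → x ∉ q
x∈p─q⇒x∉q (inside ∷ p) (outside ∷ q) here       ()
x∈p─q⇒x∉q (_ ∷ p)      (_ ∷ q)       (there x∈) (there x∈q) = x∈p─q⇒x∉q p q x∈ x∈q

∣p∪q∣≤∣p∣+∣q∣ : ∀ {m} (p q : Subset m) → ∣ p ∪ q ∣ ≤ ∣ p ∣ + ∣ q ∣
∣p∪q∣≤∣p∣+∣q∣ []            []            = z≤n
∣p∪q∣≤∣p∣+∣q∣ (outside ∷ p) (outside ∷ q) = ∣p∪q∣≤∣p∣+∣q∣ p q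
∣p∪q∣≤∣p∣+∣q∣ (outside ∷ p) (inside ∷ q)  =
  subst (suc ∣ p ∪ q ∣ ≤_) (sym (+-suc ∣ p ∣ ∣ q ∣)) (s≤s (∣p∪q∣≤∣p∣+∣q∣ p q))
∣p∪q∣≤∣p∣+∣q∣ (inside ∷ p)  (outside ∷ q) = s≤s (∣p∪q∣≤∣p∣+∣q∣ p q)
∣p∪q∣≤∣p∣+∣q∣ (inside ∷ p)  (inside ∷ q)  =
  s≤s (≤-trans (∣p∪q∣≤∣p∣+∣q∣ p q) (+-monoʳ-≤ ∣ p ∣ (n≤1+n ∣ q ∣)))

module PathDecompositions (G : Graph) where

  Vertex : Set
  Vertex = Fin (n G)

  Bags : Set
  Bags = List (Subset (n G))

  data Run (v : Vertex) : Bags → Set where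
    continue : ∀ {B Bs} → v ∈ B → Run v Bs → Run v (B ∷ Bs)
    stop     : ∀ {Bs} → All (v ∉_) Bs → Run v Bs

  data Interval (v : Vertex) : Bags → Set where
    []    : Interval v []
    skip  : ∀ {B Bs} → v ∉ B → Interval v Bs → Interval v (B ∷ Bs)
    enter : ∀ {B Bs} → v ∈ B → Run v Bs → Interval v (B ∷ Bs)

  record PathDecomposition (U : Subset (n G)) (b : ℕ) : Set where
    field
      bags         : Bags
      bags⊆        : All (_⊆ U) bags
      bag-size     : All (λ B → ∣ B ∣ ≤ b) bags
      covers       : ∀ v → v ∈ U → Any (v ∈_) bags
      covers-edges : ∀ u v → u ∈ U → v ∈ U → adj G u v ≡ true → Any (λ B → u ∈ B × v ∈ B) bags
      interval     : ∀ v → Interval v bags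

  open PathDecomposition public

  BagPath : Bags → Graph
  BagPath Bs = Path (length Bs)

  run-walks : ∀ {v} B Bs → v ∈ B → Run v Bs → ∀ i → v ∈ lookup (B ∷ Bs) i →
    PWalk (BagPath (B ∷ Bs)) (λ t → v ∈ lookup (B ∷ Bs) t) zero i ×
    PWalk (BagPath (B ∷ Bs)) (λ t → v ∈ lookup (B ∷ Bs) t) i zero
  run-walks B Bs        v∈B r            zero    _    = here v∈B , here v∈B
  run-walks B (B′ ∷ Bs) v∈B (continue v∈B′ r) (suc i) v∈Bᵢ with run-walks B′ Bs v∈B′ r i v∈Bᵢ
  ... | to , back = step v∈B refl (walk-suc (λ _ → id) to) ,
                    walk-++ (walk-suc (λ _ → id) back) (step v∈B′ refl (here v∈B))
  run-walks B Bs        v∈B (stop v∉Bs) (suc i) v∈Bᵢ = ⊥-elim (All.lookup v∉Bs (∈-lookup i) v∈Bᵢ)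

  interval-walk : ∀ {v} Bs → Interval v Bs → (i j : Fin (length Bs)) →
    v ∈ lookup Bs i → v ∈ lookup Bs j → PWalk (BagPath Bs) (λ t → v ∈ lookup Bs t) i j
  interval-walk (B ∷ Bs) (skip v∉B _)  zero    _       v∈Bᵢ _    = ⊥-elim (v∉B v∈Bᵢ)
  interval-walk (B ∷ Bs) (skip v∉B _)  (suc i) zero    _    v∈Bⱼ = ⊥-elim (v∉B v∈Bⱼ)
  interval-walk (B ∷ Bs) (skip _ iv)   (suc i) (suc j) v∈Bᵢ v∈Bⱼ =
    walk-suc (λ _ → id) (interval-walk Bs iv i j v∈Bᵢ v∈Bⱼ)
  interval-walk (B ∷ Bs) (enter v∈B r) i       j       v∈Bᵢ v∈Bⱼ =
    walk-++ (proj₂ (run-walks B Bs v∈B r i v∈Bᵢ)) (proj₁ (run-walks B Bs v∈B r j v∈Bⱼ))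

  -- An empty bag is put in front so that the path is nonempty even when G is.
  toTreeDecomposition : ∀ {w} → PathDecomposition Full (suc w) → TreeDecomposition G w
  toTreeDecomposition {w} pd = record
    { T           = BagPath Bs
    ; isTree      = Path-isTree (length (bags pd))
    ; bag         = lookup Bs
    ; vertexCover = λ v → located (covers pd v ∈⊤)
    ; edgeCover   = λ u v e → located (covers-edges pd u v ∈⊤ ∈⊤ e)
    ; coherent    = λ v → interval-walk Bs (skip ∉⊥ (interval pd v))
    ; width       = width
    }
    where
    Bs : Bags
    Bs = Empty ∷ bags pd
    located : ∀ {P : Subset (n G) → Set} → Any P (bags pd) → ∃ λ t → P (lookup Bs t)
    located p = suc (Any.index p) , Any.lookup-index p
    width : ∀ t → ∣ lookup Bs t ∣ ≤ suc w
    width zero    = subst (_≤ suc w) (sym (∣⊥∣≡0 (n G))) z≤n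
    width (suc t) = All.lookup (bag-size pd) (∈-lookup t)

  emptyDecomposition : ∀ {U b} → ¬ Nonempty U → PathDecomposition U b
  emptyDecomposition empty = record
    { bags = [] ; bags⊆ = [] ; bag-size = []
    ; covers       = λ v v∈U → ⊥-elim (empty (v , v∈U))
    ; covers-edges = λ u _ u∈U _ _ → ⊥-elim (empty (u , u∈U))
    ; interval     = λ _ → [] }

  weaken : ∀ {U b b′} → b ≤ b′ → PathDecomposition U b → PathDecomposition U b′
  weaken b≤b′ pd = record
    { bags = bags pd ; bags⊆ = bags⊆ pd
    ; bag-size = All.map (λ ≤b → ≤-trans ≤b b≤b′) (bag-size pd)
    ; covers = covers pd ; covers-edges = covers-edges pd ; interval = interval pd }

  absent-interval : ∀ {v Bs} → All (v ∉_) Bs → Interval v Bs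
  absent-interval []          = []
  absent-interval (v∉B ∷ v∉Bs) = skip v∉B (absent-interval v∉Bs)

  run-++ : ∀ {v Bs Cs} → Run v Bs → All (v ∉_) Cs → Run v (Bs ++ Cs)
  run-++ (continue v∈B r) v∉Cs = continue v∈B (run-++ r v∉Cs)
  run-++ (stop v∉Bs)      v∉Cs = stop (All.++⁺ v∉Bs v∉Cs)

  interval-++ˡ : ∀ {v Bs Cs} → Interval v Bs → All (v ∉_) Cs → Interval v (Bs ++ Cs)
  interval-++ˡ []              v∉Cs = absent-interval v∉Cs
  interval-++ˡ (skip v∉B iv)   v∉Cs = skip v∉B (interval-++ˡ iv v∉Cs)
  interval-++ˡ (enter v∈B r)   v∉Cs = enter v∈B (run-++ r v∉Cs)

  interval-++ʳ : ∀ {v Bs Cs} → All (v ∉_) Bs → Interval v Cs → Interval v (Bs ++ Cs)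
  interval-++ʳ []           iv = iv
  interval-++ʳ (v∉B ∷ v∉Bs) iv = skip v∉B (interval-++ʳ v∉Bs iv)

  absent-from-bags : ∀ {v} {U : Subset (n G)} {Bs} → v ∉ U → All (_⊆ U) Bs → All (v ∉_) Bs
  absent-from-bags v∉U = All.map (λ B⊆U v∈B → v∉U (B⊆U v∈B))

  NoEdgesBetween : Subset (n G) → Subset (n G) → Set
  NoEdgesBetween C D = ∀ x y → x ∈ C → y ∈ D → adj G x y ≡ true → ⊥

  -- Every vertex occurs in the bags of only one of the two parts, so intervals survive.
  concatenate : ∀ {W C : Subset (n G)} {b} → C ⊆ W → NoEdgesBetween C (W ─ C) →
    PathDecomposition C b → PathDecomposition (W ─ C) b → PathDecomposition W b
  concatenate {W} {C} C⊆W no-edges pdC pdD = record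
    { bags         = bags pdC ++ bags pdD
    ; bags⊆        = All.++⁺ (All.map (λ B⊆C {x} x∈B → C⊆W (B⊆C x∈B)) (bags⊆ pdC))
                             (All.map (λ B⊆D {x} x∈B → p─q⊆p W C (B⊆D x∈B)) (bags⊆ pdD))
    ; bag-size     = All.++⁺ (bag-size pdC) (bag-size pdD)
    ; covers       = covers′
    ; covers-edges = covers-edges′
    ; interval     = interval′
    }
    where
    side : ∀ {x} → x ∈ W → x ∈ C ⊎ x ∈ W ─ C
    side {x} x∈W with x ∈? C
    ... | yes x∈C = inj₁ x∈C
    ... | no  x∉C = inj₂ (x∈p∧x∉q⇒x∈p─q x∈W x∉C)
    covers′ : ∀ v → v ∈ W → Any (v ∈_) (bags pdC ++ bags pdD)
    covers′ v v∈W with side v∈W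
    ... | inj₁ v∈C = Any.++⁺ˡ (covers pdC v v∈C)
    ... | inj₂ v∈D = Any.++⁺ʳ (bags pdC) (covers pdD v v∈D)
    covers-edges′ : ∀ u v → u ∈ W → v ∈ W → adj G u v ≡ true →
      Any (λ B → u ∈ B × v ∈ B) (bags pdC ++ bags pdD)
    covers-edges′ u v u∈W v∈W e with side u∈W | side v∈W
    ... | inj₁ u∈C | inj₁ v∈C = Any.++⁺ˡ (covers-edges pdC u v u∈C v∈C e)
    ... | inj₂ u∈D | inj₂ v∈D = Any.++⁺ʳ (bags pdC) (covers-edges pdD u v u∈D v∈D e)
    ... | inj₁ u∈C | inj₂ v∈D = ⊥-elim (no-edges u v u∈C v∈D e)
    ... | inj₂ u∈D | inj₁ v∈C = ⊥-elim (no-edges v u v∈C u∈D (trans (Graph.sym G v u) e))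
    interval′ : ∀ v → Interval v (bags pdC ++ bags pdD)
    interval′ v with v ∈? C
    ... | yes v∈C = interval-++ˡ (interval pdC v) (absent-from-bags (λ v∈D → x∈p─q⇒x∉q W C v∈D v∈C) (bags⊆ pdD))
    ... | no  v∉C = interval-++ʳ (absent-from-bags v∉C (bags⊆ pdC)) (interval pdD v)

  -- Each vertex of S occupies an initial run of the new bags.
  adjoin : ∀ {U S : Subset (n G)} {b} → S ⊆ U →
    PathDecomposition (U ─ S) b → PathDecomposition U (∣ S ∣ + b)
  adjoin {U} {S} {b} S⊆U pd = record
    { bags         = S ∷ map (_∪ S) (bags pd)
    ; bags⊆        = S⊆U ∷ All.map⁺ (All.map ∪S⊆U (bags⊆ pd))
    ; bag-size     = m≤m+n ∣ S ∣ b ∷ All.map⁺ (All.map (λ {B} → size B) (bag-size pd))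
    ; covers       = covers′
    ; covers-edges = covers-edges′
    ; interval     = interval′
    }
    where
    ∪S⊆U : ∀ {B} → B ⊆ U ─ S → B ∪ S ⊆ U
    ∪S⊆U {B} B⊆ x∈ = [ (λ x∈B → p─q⊆p U S (B⊆ x∈B)) , S⊆U ]′ (x∈p∪q⁻ B S x∈)
    size : ∀ B → ∣ B ∣ ≤ b → ∣ B ∪ S ∣ ≤ ∣ S ∣ + b
    size B ≤b = ≤-trans (∣p∪q∣≤∣p∣+∣q∣ B S) (subst (_≤ ∣ S ∣ + b) (+-comm ∣ S ∣ ∣ B ∣) (+-monoʳ-≤ ∣ S ∣ ≤b))
    ∪S⁺ : ∀ {P Q : Subset (n G) → Set} {Bs} → (∀ {B} → P B → Q (B ∪ S)) → Any P Bs → Any Q (map (_∪ S) Bs)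
    ∪S⁺ f p = Any.map⁺ (Any.map f p)
    rest : ∀ {v} → v ∈ U → v ∉ S → v ∈ U ─ S
    rest = x∈p∧x∉q⇒x∈p─q
    covers′ : ∀ v → v ∈ U → Any (v ∈_) (S ∷ map (_∪ S) (bags pd))
    covers′ v v∈U with v ∈? S
    ... | yes v∈S = Any.here v∈S
    ... | no  v∉S = Any.there (∪S⁺ (x∈p∪q⁺ ∘ inj₁) (covers pd v (rest v∈U v∉S)))
    covers-edges′ : ∀ u v → u ∈ U → v ∈ U → adj G u v ≡ true →
      Any (λ B → u ∈ B × v ∈ B) (S ∷ map (_∪ S) (bags pd))
    covers-edges′ u v u∈U v∈U e with u ∈? S | v ∈? S
    ... | yes u∈S | yes v∈S = Any.here (u∈S , v∈S)
    ... | yes u∈S | no  v∉S = Any.there (∪S⁺ (λ v∈B → x∈p∪q⁺ (inj₂ u∈S) , x∈p∪q⁺ (inj₁ v∈B))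
                                             (covers pd v (rest v∈U v∉S)))
    ... | no  u∉S | yes v∈S = Any.there (∪S⁺ (λ u∈B → x∈p∪q⁺ (inj₁ u∈B) , x∈p∪q⁺ (inj₂ v∈S))
                                             (covers pd u (rest u∈U u∉S)))
    ... | no  u∉S | no  v∉S = Any.there (∪S⁺ (λ uv∈B → x∈p∪q⁺ (inj₁ (proj₁ uv∈B)) , x∈p∪q⁺ (inj₁ (proj₂ uv∈B)))
                                             (covers-edges pd u v (rest u∈U u∉S) (rest v∈U v∉S) e))
    run-of-separator : ∀ {v} → v ∈ S → ∀ Bs → Run v (map (_∪ S) Bs)
    run-of-separator v∈S []       = stop []
    run-of-separator v∈S (B ∷ Bs) = continue (x∈p∪q⁺ (inj₂ v∈S)) (run-of-separator v∈S Bs)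
    ∉∪S : ∀ {v B} → v ∉ S → v ∉ B → v ∉ B ∪ S
    ∉∪S {B = B} v∉S v∉B v∈ = [ v∉B , v∉S ]′ (x∈p∪q⁻ B S v∈)
    run-∪S : ∀ {v} → v ∉ S → ∀ {Bs} → Run v Bs → Run v (map (_∪ S) Bs)
    run-∪S v∉S (continue v∈B r) = continue (x∈p∪q⁺ (inj₁ v∈B)) (run-∪S v∉S r)
    run-∪S v∉S (stop v∉Bs)      = stop (All.map⁺ (All.map (∉∪S v∉S) v∉Bs))
    interval-∪S : ∀ {v} → v ∉ S → ∀ {Bs} → Interval v Bs → Interval v (map (_∪ S) Bs)
    interval-∪S v∉S []            = []
    interval-∪S v∉S (skip v∉B iv) = skip (∉∪S v∉S v∉B) (interval-∪S v∉S iv)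
    interval-∪S v∉S (enter v∈B r) = enter (x∈p∪q⁺ (inj₁ v∈B)) (run-∪S v∉S r)
    interval′ : ∀ v → Interval v (S ∷ map (_∪ S) (bags pd))
    interval′ v with v ∈? S
    ... | yes v∈S = enter v∈S (run-of-separator v∈S (bags pd))
    ... | no  v∉S = skip v∉S (interval-∪S v∉S (interval pd v))

select : ∀ {m} {Q : Fin m → Set} → Decidable Q → Subset m
select Q? = Vec.tabulate (does ∘ Q?)

∈-select⁻ : ∀ {m} {Q : Fin m → Set} (Q? : Decidable Q) {u} → u ∈ select Q? → Q u
∈-select⁻ Q? {u} u∈ with Q? u | trans (sym (lookup∘tabulate (does ∘ Q?) u)) ([]=⇒lookup u∈)
... | yes q | _ = q

∈-select⁺ : ∀ {m} {Q : Fin m → Set} (Q? : Decidable Q) {u} → Q u → u ∈ select Q?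
∈-select⁺ Q? {u} q = lookup⇒[]= u _ (trans (lookup∘tabulate (does ∘ Q?) u) (holds (Q? u)))
  where
  holds : (d : Dec _) → does d ≡ true
  holds (yes _) = refl
  holds (no ¬q) = ⊥-elim (¬q q)

x∈p⇒0<∣p∣ : ∀ {m} {p : Subset m} {x} → x ∈ p → 0 < ∣ p ∣
x∈p⇒0<∣p∣ {p = p} {x} x∈p =
  subst (_≤ ∣ p ∣) (∣⁅x⁆∣≡1 x) (p⊆q⇒∣p∣≤∣q∣ (λ y∈ → subst (_∈ p) (sym (x∈⁅y⁆⇒x≡y x y∈)) x∈p))

Component : (G : Graph) → (Fin (n G) → Set) → Fin (n G) → Subset (n G) → Set
Component G P v C = ∀ u → (u ∈ C → PWalk G P v u) × (PWalk G P v u → u ∈ C)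

module Components (G : Graph) where
  open PathDecompositions G

  Closed : Subset (n G) → Subset (n G) → Set
  Closed W C = ∀ x u → x ∈ C → u ∈ W → adj G x u ≡ true → u ∈ C

  walk-stays-in : ∀ {W C} → Closed W C → ∀ {a u} → a ∈ C → PWalk G (_∈ W) a u → u ∈ C
  walk-stays-in closed a∈C (here _)     = a∈C
  walk-stays-in closed a∈C (step _ e w) = walk-stays-in closed (closed _ _ a∈C (walk-head w) e) w

  module _ (W : Subset (n G)) (v : Vertex) (v∈W : v ∈ W) where

    Reachable : Subset (n G) → Set
    Reachable R = ∀ u → u ∈ R → PWalk G (_∈ W) v u

    Grown : Subset (n G) → Vertex → Set
    Grown R u = u ∈ R ⊎ (u ∈ W × ∃ λ x → x ∈ R × adj G x u ≡ true)

    grown? : ∀ R → Decidable (Grown R)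
    grown? R u = (u ∈? R) ⊎-dec ((u ∈? W) ×-dec any? (λ x → (x ∈? R) ×-dec (adj G x u Bool.≟ true)))

    -- Each round either adds a vertex or finds a closed set, so n G rounds suffice.
    grow : ∀ (fuel : ℕ) R → Reachable R → v ∈ R → n G < ∣ R ∣ + fuel →
      Σ (Subset (n G)) λ C → Reachable C × v ∈ C × Closed W C
    grow zero R _ _ lt = ⊥-elim (<⇒≱ lt (subst (_≤ n G) (sym (+-identityʳ ∣ R ∣)) (∣p∣≤n R)))
    grow (suc fuel) R reach v∈R lt with any? (λ u → (u ∈? select (grown? R)) ×-dec ¬? (u ∈? R))
    ... | yes (u , u∈R′ , u∉R) = grow fuel R′ reach′ (R⊆R′ v∈R) lt′
      where
      R′ : Subset (n G)
      R′ = select (grown? R)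
      R⊆R′ : R ⊆ R′
      R⊆R′ x∈R = ∈-select⁺ (grown? R) (inj₁ x∈R)
      reach′ : Reachable R′
      reach′ x x∈R′ with ∈-select⁻ (grown? R) x∈R′
      ... | inj₁ x∈R = reach x x∈R
      ... | inj₂ (x∈W , y , y∈R , e) = walk-++ (reach y y∈R) (step (walk-last (reach y y∈R)) e (here x∈W))
      lt′ : n G < ∣ R′ ∣ + fuel
      lt′ = <-≤-trans lt (subst (_≤ ∣ R′ ∣ + fuel) (sym (+-suc ∣ R ∣ fuel))
                               (+-monoˡ-≤ fuel (p⊂q⇒∣p∣<∣q∣ (R⊆R′ , u , u∈R′ , u∉R))))
    ... | no saturated = R , reach , v∈R , closed
      where
      closed : Closed W R
      closed x u x∈R u∈W e with u ∈? R
      ... | yes u∈R = u∈R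
      ... | no  u∉R = ⊥-elim (saturated (u , ∈-select⁺ (grown? R) (inj₂ (u∈W , x , x∈R , e)) , u∉R))

    component : Σ (Subset (n G)) λ C → Component G (_∈ W) v C × v ∈ C
    component with grow (n G) ⁅ v ⁆ start (x∈⁅x⁆ v) (subst (λ s → n G < s + n G) (sym (∣⁅x⁆∣≡1 v)) ≤-refl)
      where
      start : Reachable ⁅ v ⁆
      start u u∈ = subst (PWalk G (_∈ W) v) (sym (x∈⁅y⁆⇒x≡y v u∈)) (here v∈W)
    ... | C , reach , v∈C , closed = C , (λ u → reach u , walk-stays-in closed v∈C) , v∈C

  component-closed : ∀ {W v C} → Component G (_∈ W) v C → Closed W C
  component-closed comp x u x∈C u∈W e =
    proj₂ (comp u) (walk-++ (proj₁ (comp x) x∈C) (step (walk-last (proj₁ (comp x) x∈C)) e (here u∈W)))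

  walk-in-remainder : ∀ {W C} → Closed W C → ∀ {x u} → x ∈ W ─ C → PWalk G (_∈ W) x u → PWalk G (_∈ W ─ C) x u
  walk-in-remainder closed x∈D (here _) = here x∈D
  walk-in-remainder {W} {C} closed {x} x∈D (step {w = y} _ e w) with y ∈? C
  ... | yes y∈C = ⊥-elim (x∈p─q⇒x∉q W C x∈D (closed y x y∈C (p─q⊆p W C x∈D) (trans (Graph.sym G y x) e)))
  ... | no  y∉C = step x∈D e (walk-in-remainder closed (x∈p∧x∉q⇒x∈p─q (walk-head w) y∉C) w)

  component-of-remainder : ∀ {W C D x} → Closed W C → x ∈ W ─ C →
    Component G (_∈ W ─ C) x D → Component G (_∈ W) x D
  component-of-remainder {W} {C} closed x∈ comp u =
    (λ u∈D → walk-map (λ y → p─q⊆p W C) (proj₁ (comp u) u∈D)) ,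
    (λ w → proj₂ (comp u) (walk-in-remainder closed x∈ w))

  byComponents : ∀ b W → (∀ x C → x ∈ W → Component G (_∈ W) x C → PathDecomposition C b) →
    PathDecomposition W b
  byComponents b W = go ∣ W ∣ W ≤-refl
    where
    go : ∀ fuel W → ∣ W ∣ ≤ fuel →
      (∀ x C → x ∈ W → Component G (_∈ W) x C → PathDecomposition C b) → PathDecomposition W b
    go fuel W _ pdComp with nonempty? W
    ... | no empty = emptyDecomposition empty
    go zero W size≤ pdComp | yes (v , v∈W) = ⊥-elim (<⇒≱ (x∈p⇒0<∣p∣ v∈W) size≤)
    go (suc fuel) W size≤ pdComp | yes (v , v∈W) with component W v v∈W
    ... | C , comp , v∈C = concatenate C⊆W no-edges (pdComp v C v∈W comp)
                             (go fuel (W ─ C) size≤′ λ x D x∈ compD →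
                                pdComp x D (p─q⊆p W C x∈) (component-of-remainder closed x∈ compD))
      where
      closed : Closed W C
      closed = component-closed comp
      C⊆W : C ⊆ W
      C⊆W {x} x∈C = walk-last (proj₁ (comp x) x∈C)
      no-edges : NoEdgesBetween C (W ─ C)
      no-edges x y x∈C y∈D e = x∈p─q⇒x∉q W C y∈D (closed x y x∈C (p─q⊆p W C y∈D) e)
      size≤′ : ∣ W ─ C ∣ ≤ fuel
      size≤′ = ≤-pred (≤-trans (p∩q≢∅⇒∣p─q∣<∣p∣ W C (v , x∈p∩q⁺ (v∈W , v∈C))) size≤)

module SeparatorRecursion (G : Graph) (β : ℕ → ℕ) where
  open PathDecompositions G
  open Components G

  -- β k bounds the bag size for sets of at most k vertices; a separation of U pays for its
  -- separator out of β (suc k) and leaves components of size at most k′.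
  record Separation (k : ℕ) (U : Subset (n G)) : Set where
    field
      separator        : Subset (n G)
      separator⊆       : separator ⊆ U
      k′               : ℕ
      k′≤k             : k′ ≤ k
      components-small : ∀ x C → x ∈ U ─ separator → Component G (_∈ U ─ separator) x C → ∣ C ∣ ≤ k′
      within-budget    : ∣ separator ∣ + β k′ ≤ β (suc k)

  decompose : (∀ k U → ∣ U ∣ ≤ suc k → Separation k U) →
    ∀ k U → ∣ U ∣ ≤ k → PathDecomposition U (β k)
  decompose separate = <-rec (λ k → ∀ U → ∣ U ∣ ≤ k → PathDecomposition U (β k)) split
    where
    split : ∀ k → (∀ {k′} → k′ < k → ∀ U → ∣ U ∣ ≤ k′ → PathDecomposition U (β k′)) →
      ∀ U → ∣ U ∣ ≤ k → PathDecomposition U (β k)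
    split zero _ U size≤ with nonempty? U
    ... | yes (v , v∈U) = ⊥-elim (<⇒≱ (x∈p⇒0<∣p∣ v∈U) size≤)
    ... | no empty      = emptyDecomposition empty
    split (suc k) rec U size≤ =
      weaken within-budget (adjoin separator⊆
        (byComponents (β k′) (U ─ separator)
          (λ x C x∈ comp → rec (s≤s k′≤k) C (components-small x C x∈ comp))))
      where open Separation (separate k U size≤)

∈⇒≤sum : ∀ {x xs} → x ∈ₗ xs → x ≤ sum xs
∈⇒≤sum {xs = y ∷ ys} (Any.here refl) = m≤m+n y (sum ys)
∈⇒≤sum {xs = y ∷ ys} (Any.there x∈) = ≤-trans (∈⇒≤sum x∈) (m≤n+m (sum ys) y)

∈⇒≤foldr⊔ : ∀ {x xs} → x ∈ₗ xs → x ≤ foldr _⊔_ 0 xs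
∈⇒≤foldr⊔ {xs = y ∷ ys} (Any.here refl) = m≤m⊔n y (foldr _⊔_ 0 ys)
∈⇒≤foldr⊔ {xs = y ∷ ys} (Any.there x∈) = ≤-trans (∈⇒≤foldr⊔ x∈) (m≤n⊔m y (foldr _⊔_ 0 ys))

∑ : ∀ k → (Fin k → ℕ) → ℕ
∑ k g = sum (map g (allFin k))

∑-suc : ∀ k (g : Fin (suc k) → ℕ) → ∑ (suc k) g ≡ g zero + ∑ k (g ∘ suc)
∑-suc k g = cong (λ xs → g zero + sum xs) (trans (map-tabulate suc g) (sym (map-tabulate id (g ∘ suc))))

∑-mono-≤ : ∀ k {f g : Fin k → ℕ} → (∀ i → f i ≤ g i) → ∑ k f ≤ ∑ k g
∑-mono-≤ zero    _   = z≤n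
∑-mono-≤ (suc k) {f} {g} f≤g = subst₂ _≤_ (sym (∑-suc k f)) (sym (∑-suc k g))
  (+-mono-≤ (f≤g zero) (∑-mono-≤ k (f≤g ∘ suc)))

∑-const : ∀ k d → ∑ k (λ _ → d) ≡ k * d
∑-const zero    d = refl
∑-const (suc k) d = trans (∑-suc k (λ _ → d)) (cong (d +_) (∑-const k d))

term≤∑ : ∀ k (g : Fin k → ℕ) i → g i ≤ ∑ k g
term≤∑ k g i = ∈⇒≤sum (∈-map⁺ g (∈-allFin i))

indicator : Bool → ℕ
indicator b = if b then 1 else 0

degree≤maxDeg : ∀ G v → degree G v ≤ maxDeg G
degree≤maxDeg G v = ∈⇒≤foldr⊔ (∈-map⁺ (degree G) (∈-allFin v))

edge⇒0<maxDeg : ∀ G u v → adj G u v ≡ true → 0 < maxDeg G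
edge⇒0<maxDeg G u v e = ≤-trans (subst (λ b → 1 ≤ indicator b) (sym e) ≤-refl)
  (≤-trans (term≤∑ (n G) (indicator ∘ adj G u) v) (degree≤maxDeg G u))

embed : ∀ {m} (p : Subset m) → Fin ∣ p ∣ → Fin m
embed (inside ∷ p)  zero    = zero
embed (inside ∷ p)  (suc j) = suc (embed p j)
embed (outside ∷ p) j       = suc (embed p j)

embed-∈ : ∀ {m} (p : Subset m) j → embed p j ∈ p
embed-∈ (inside ∷ p)  zero    = here
embed-∈ (inside ∷ p)  (suc j) = there (embed-∈ p j)
embed-∈ (outside ∷ p) j       = there (embed-∈ p j)

embed-injective : ∀ {m} (p : Subset m) {i j} → embed p i ≡ embed p j → i ≡ j
embed-injective (inside ∷ p)  {zero}  {zero}  _ = refl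
embed-injective (inside ∷ p)  {suc i} {suc j} e = cong suc (embed-injective p (Fin-suc-injective e))
embed-injective (outside ∷ p)               e = embed-injective p (Fin-suc-injective e)

embed-onto : ∀ {m} (p : Subset m) {x} → x ∈ p → ∃ λ j → embed p j ≡ x
embed-onto (inside ∷ p)  here       = zero , refl
embed-onto (inside ∷ p)  (there x∈) with embed-onto p x∈
... | j , e = suc j , cong suc e
embed-onto (outside ∷ p) (there x∈) with embed-onto p x∈
... | j , e = j , cong suc e

image : ∀ {m} (p : Subset m) → Subset ∣ p ∣ → Subset m
image []            T       = []
image (inside ∷ p)  (t ∷ T) = t ∷ image p T
image (outside ∷ p) T       = outside ∷ image p T

∣image∣ : ∀ {m} (p : Subset m) T → ∣ image p T ∣ ≡ ∣ T ∣
∣image∣ []            []            = refl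
∣image∣ (inside ∷ p)  (inside ∷ T)  = cong suc (∣image∣ p T)
∣image∣ (inside ∷ p)  (outside ∷ T) = ∣image∣ p T
∣image∣ (outside ∷ p) T             = ∣image∣ p T

∈-image⁺ : ∀ {m} (p : Subset m) T {j} → j ∈ T → embed p j ∈ image p T
∈-image⁺ (inside ∷ p)  (t ∷ T) here       = here
∈-image⁺ (inside ∷ p)  (t ∷ T) (there j∈) = there (∈-image⁺ p T j∈)
∈-image⁺ (outside ∷ p) T       j∈         = there (∈-image⁺ p T j∈)

∈-image⁻ : ∀ {m} (p : Subset m) T {j} → embed p j ∈ image p T → j ∈ T
∈-image⁻ (inside ∷ p)  (t ∷ T) {zero}  here       = here
∈-image⁻ (inside ∷ p)  (t ∷ T) {suc j} (there x∈) = there (∈-image⁻ p T x∈)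
∈-image⁻ (outside ∷ p) T               (there x∈) = ∈-image⁻ p T x∈

image⊆ : ∀ {m} (p : Subset m) T → image p T ⊆ p
image⊆ (inside ∷ p)  (t ∷ T) here       = here
image⊆ (inside ∷ p)  (t ∷ T) (there x∈) = there (image⊆ p T x∈)
image⊆ (outside ∷ p) T       (there x∈) = there (image⊆ p T x∈)

preimage : ∀ {m} (p : Subset m) → Subset m → Subset ∣ p ∣
preimage []            []      = []
preimage (inside ∷ p)  (c ∷ C) = c ∷ preimage p C
preimage (outside ∷ p) (c ∷ C) = preimage p C

∈-preimage⁺ : ∀ {m} (p : Subset m) C {j} → embed p j ∈ C → j ∈ preimage p C
∈-preimage⁺ (inside ∷ p)  (c ∷ C) {zero}  here       = here
∈-preimage⁺ (inside ∷ p)  (c ∷ C) {suc j} (there x∈) = there (∈-preimage⁺ p C x∈)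
∈-preimage⁺ (outside ∷ p) (c ∷ C)         (there x∈) = ∈-preimage⁺ p C x∈

∈-preimage⁻ : ∀ {m} (p : Subset m) C {j} → j ∈ preimage p C → embed p j ∈ C
∈-preimage⁻ (inside ∷ p)  (c ∷ C) here       = here
∈-preimage⁻ (inside ∷ p)  (c ∷ C) (there j∈) = there (∈-preimage⁻ p C j∈)
∈-preimage⁻ (outside ∷ p) (c ∷ C) j∈         = there (∈-preimage⁻ p C j∈)

∣preimage∣ : ∀ {m} (p : Subset m) C → C ⊆ p → ∣ preimage p C ∣ ≡ ∣ C ∣
∣preimage∣ []            []            _   = refl
∣preimage∣ (inside ∷ p)  (inside ∷ C)  C⊆p = cong suc (∣preimage∣ p C (drop-∷-⊆ C⊆p))
∣preimage∣ (inside ∷ p)  (outside ∷ C) C⊆p = ∣preimage∣ p C (drop-∷-⊆ C⊆p)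
∣preimage∣ (outside ∷ p) (outside ∷ C) C⊆p = ∣preimage∣ p C (drop-∷-⊆ C⊆p)
∣preimage∣ (outside ∷ p) (inside ∷ C)  C⊆p with C⊆p here
... | ()

∑-embed≤∑ : ∀ {m} (p : Subset m) (g : Fin m → ℕ) → ∑ ∣ p ∣ (g ∘ embed p) ≤ ∑ m g
∑-embed≤∑ []                    g = z≤n
∑-embed≤∑ {suc m} (inside ∷ p)  g = subst₂ _≤_ (sym (∑-suc ∣ p ∣ (g ∘ embed (inside ∷ p)))) (sym (∑-suc m g))
  (+-monoʳ-≤ (g zero) (∑-embed≤∑ p (g ∘ suc)))
∑-embed≤∑ {suc m} (outside ∷ p) g = subst (∑ ∣ p ∣ (g ∘ suc ∘ embed p) ≤_) (sym (∑-suc m g))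
  (≤-trans (∑-embed≤∑ p (g ∘ suc)) (m≤n+m _ _))

Induced : (G : Graph) → Subset (n G) → Graph
Induced G U = record
  { n      = ∣ U ∣
  ; adj    = λ i j → adj G (embed U i) (embed U j)
  ; sym    = λ i j → Graph.sym G (embed U i) (embed U j)
  ; irrefl = λ i → irrefl G (embed U i)
  }

Induced-inducedSubgraph : ∀ G U → InducedSubgraph (Induced G U) G
Induced-inducedSubgraph G U = embed U , embed-injective U , λ _ _ → refl

edgeCount-Induced : ∀ G U → edgeCount (Induced G U) ≤ ∣ U ∣ * maxDeg G
edgeCount-Induced G U = begin
  edgeCount H             ≤⟨ ∑-mono-≤ k (λ i → ∑-mono-≤ k (λ j → drop-order (adj H i j))) ⟩
  ∑ k (degree H)          ≤⟨ ∑-mono-≤ k degree-H≤Δ ⟩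
  ∑ k (λ _ → maxDeg G)    ≡⟨ ∑-const k (maxDeg G) ⟩
  k * maxDeg G            ∎
  where
  open ≤-Reasoning
  H : Graph
  H = Induced G U
  k : ℕ
  k = ∣ U ∣
  drop-order : ∀ {a} b → indicator (a ∧ b) ≤ indicator b
  drop-order {false} false = z≤n
  drop-order {false} true  = z≤n
  drop-order {true}  b     = ≤-refl
  degree-H≤Δ : ∀ i → degree H i ≤ maxDeg G
  degree-H≤Δ i = ≤-trans (∑-embed≤∑ U (indicator ∘ adj G (embed U i))) (degree≤maxDeg G (embed U i))

module _ (G : Graph) (U : Subset (n G)) (T : Subset ∣ U ∣) where
  private
    H : Graph
    H = Induced G U
    S : Subset (n G)
    S = image U T

    outside-image : ∀ {i x} → embed U i ≡ x → x ∈ U ─ S → i ∉ T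
    outside-image {i} e x∈ i∈T = x∈p─q⇒x∉q U S x∈ (subst (_∈ S) e (∈-image⁺ U T i∈T))

    inside-remainder : ∀ {i} → i ∉ T → embed U i ∈ U ─ S
    inside-remainder i∉T = x∈p∧x∉q⇒x∈p─q (embed-∈ U _) (i∉T ∘ ∈-image⁻ U T)

    walk-embed : ∀ {i j} → PWalk H (_∉ T) i j → PWalk G (_∈ U ─ S) (embed U i) (embed U j)
    walk-embed (here i∉T)     = here (inside-remainder i∉T)
    walk-embed (step i∉T e w) = step (inside-remainder i∉T) e (walk-embed w)

    walk-pullback : ∀ {x y} → PWalk G (_∈ U ─ S) x y →
      ∀ i j → embed U i ≡ x → embed U j ≡ y → PWalk H (_∉ T) i j
    walk-pullback (here x∈) i j eᵢ eⱼ =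
      subst (PWalk H (_∉ T) i) (embed-injective U (trans eᵢ (sym eⱼ))) (here (outside-image eᵢ x∈))
    walk-pullback (step x∈ e w) i j eᵢ eⱼ with embed-onto U (p─q⊆p U S (walk-head w))
    ... | k , eₖ = step (outside-image eᵢ x∈) (subst₂ (λ a b → adj G a b ≡ true) (sym eᵢ) (sym eₖ) e)
                        (walk-pullback w k j eₖ eⱼ)

  -- A component of G restricted to U ─ S is, read inside the induced subgraph, a component
  -- of H ─ T, so the balance of T carries over.
  balanced-image : Balanced (Induced G U) T → ∀ x C → x ∈ U ─ image U T →
    Component G (_∈ U ─ image U T) x C → 3 * ∣ C ∣ ≤ 2 * ∣ U ∣
  balanced-image balanced x C x∈ comp with embed-onto U (p─q⊆p U S x∈)
  ... | j , eⱼ = subst (λ s → 3 * s ≤ 2 * ∣ U ∣) (∣preimage∣ U C C⊆U)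
                   (balanced j (outside-image eⱼ x∈) (preimage U C) compH)
    where
    C⊆U : C ⊆ U
    C⊆U {y} y∈C = p─q⊆p U S (walk-last (proj₁ (comp y) y∈C))
    compH : Component H (_∉ T) j (preimage U C)
    compH u = (λ u∈ → walk-pullback (proj₁ (comp (embed U u)) (∈-preimage⁻ U C u∈)) j u eⱼ refl) ,
              (λ w → ∈-preimage⁺ U C (proj₂ (comp (embed U u))
                       (subst (λ a → PWalk G (_∈ U ─ S) a (embed U u)) eⱼ (walk-embed w))))

⌊√_⌋ : ℕ → ℕ
⌊√ zero ⌋  = 0
⌊√ suc N ⌋ with suc ⌊√ N ⌋ * suc ⌊√ N ⌋ ≤? suc N
... | yes _ = suc ⌊√ N ⌋
... | no  _ = ⌊√ N ⌋

⌊√⌋-bounds : ∀ N → ⌊√ N ⌋ * ⌊√ N ⌋ ≤ N × N < suc ⌊√ N ⌋ * suc ⌊√ N ⌋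
⌊√⌋-bounds zero = z≤n , s≤s z≤n
⌊√⌋-bounds (suc N) with ⌊√⌋-bounds N | suc ⌊√ N ⌋ * suc ⌊√ N ⌋ ≤? suc N
... | _ , N< | yes fits = fits , <-≤-trans (s≤s N<) (*-mono-< (n<1+n (suc ⌊√ N ⌋)) (n<1+n (suc ⌊√ N ⌋)))
... | r²≤N , _ | no  over = ≤-trans r²≤N (n≤1+n N) , ≰⇒> over

⌊√⌋² : ∀ N → ⌊√ N ⌋ * ⌊√ N ⌋ ≤ N
⌊√⌋² N = proj₁ (⌊√⌋-bounds N)

≤⌊√⌋ : ∀ s N → s * s ≤ N → s ≤ ⌊√ N ⌋
≤⌊√⌋ s N s²≤N with s ≤? ⌊√ N ⌋
... | yes s≤r = s≤r
... | no  s≰r = ⊥-elim (<⇒≱ (proj₂ (⌊√⌋-bounds N)) (≤-trans (*-mono-≤ (≰⇒> s≰r) (≰⇒> s≰r)) s²≤N))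

2xy≤x²+y² : ∀ x y → 2 * (x * y) ≤ x * x + y * y
2xy≤x²+y² zero    y       = z≤n
2xy≤x²+y² (suc x) zero    = subst (_≤ suc x * suc x + 0) (sym (cong (2 *_) (*-zeroʳ (suc x)))) z≤n
2xy≤x²+y² (suc x) (suc y) = subst₂ _≤_ (sym (lhs x y)) (sym (rhs x y))
  (+-monoˡ-≤ (2 * x + 2 * y + 2) (2xy≤x²+y² x y))
  where
  lhs : ∀ x y → 2 * (suc x * suc y) ≡ 2 * (x * y) + (2 * x + 2 * y + 2)
  lhs = solve-∀
  rhs : ∀ x y → suc x * suc x + suc y * suc y ≡ x * x + y * y + (2 * x + 2 * y + 2)
  rhs = solve-∀

-- (a + b)² ≤ 4 a² + (4/3) b², from 2 (3a) b ≤ (3a)² + b².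
square-sum≤ : ∀ a b → 9 * ((a + b) * (a + b)) ≤ 36 * (a * a) + 12 * (b * b)
square-sum≤ a b = subst₂ _≤_ (sym (lhs a b)) (rhs a b)
  (+-monoˡ-≤ (9 * (b * b)) (+-monoʳ-≤ (9 * (a * a)) (*-monoʳ-≤ 3 (2xy≤x²+y² (3 * a) b))))
  where
  lhs : ∀ a b → 9 * ((a + b) * (a + b)) ≡ 9 * (a * a) + 3 * (2 * ((3 * a) * b)) + 9 * (b * b)
  lhs = solve-∀
  rhs : ∀ a b → 9 * (a * a) + 3 * ((3 * a) * (3 * a) + b * b) + 9 * (b * b) ≡ 36 * (a * a) + 12 * (b * b)
  rhs = solve-∀

-- The largest size a component may have inside a set of k + 1 vertices.
twoThirds : ℕ → ℕ
twoThirds k = (2 * suc k) / 3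

twoThirds≤ : ∀ k → twoThirds k ≤ k
twoThirds≤ k = ≤-pred (m<n*o⇒m/o<n {2 * suc k} {suc k} {3} (subst (suc (2 * suc k) ≤_) (sym (e k)) (m≤m+n _ k)))
  where
  e : ∀ k → suc k * 3 ≡ suc (2 * suc k) + k
  e = solve-∀

≤twoThirds : ∀ k y → 3 * y ≤ 2 * suc k → y ≤ twoThirds k
≤twoThirds k y 3y≤ = subst (_≤ twoThirds k) (m*n/n≡m y 3) (/-monoˡ-≤ 3 (subst (_≤ 2 * suc k) (*-comm 3 y) 3y≤))

3*twoThirds≤ : ∀ k → 3 * twoThirds k ≤ 2 * suc k
3*twoThirds≤ k = subst (_≤ 2 * suc k) (*-comm (twoThirds k) 3) (m/n*n≤m (2 * suc k) 3)

module Budget (c Δ : ℕ) where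

  separatorBound : ℕ → ℕ
  separatorBound k = ⌊√ c * (k * Δ + 1) ⌋

  -- budgetWithin fuel k unfolds the recurrence budget (k + 1) = separatorBound (k + 1) + budget (twoThirds k);
  -- the fuel only ensures termination and is irrelevant once it is at least k.
  budgetWithin : ℕ → ℕ → ℕ
  budgetWithin zero       _       = 0
  budgetWithin (suc fuel) zero    = 0
  budgetWithin (suc fuel) (suc k) = separatorBound (suc k) + budgetWithin fuel (twoThirds k)

  budgetWithin-zero : ∀ fuel → budgetWithin fuel 0 ≡ 0
  budgetWithin-zero zero       = refl
  budgetWithin-zero (suc fuel) = refl

  budgetWithin-stable : ∀ f₁ f₂ k → k ≤ f₁ → k ≤ f₂ → budgetWithin f₁ k ≡ budgetWithin f₂ k
  budgetWithin-stable f₁ f₂ zero _ _ = trans (budgetWithin-zero f₁) (sym (budgetWithin-zero f₂))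
  budgetWithin-stable (suc f₁) (suc f₂) (suc k) (s≤s k≤f₁) (s≤s k≤f₂) =
    cong (separatorBound (suc k) +_)
      (budgetWithin-stable f₁ f₂ (twoThirds k) (≤-trans (twoThirds≤ k) k≤f₁) (≤-trans (twoThirds≤ k) k≤f₂))

  budget : ℕ → ℕ
  budget k = budgetWithin k k

  budget-suc : ∀ k → budget (suc k) ≡ separatorBound (suc k) + budget (twoThirds k)
  budget-suc k = cong (separatorBound (suc k) +_) (budgetWithin-stable k (twoThirds k) (twoThirds k) (twoThirds≤ k) ≤-refl)

  -- With a ≤ √(2 c X), b² ≤ 72 c (2/3) X and X = (k + 1) Δ ≥ 1, square-sum≤ gives
  -- 9 (a + b)² ≤ 72 c X + 8 · 72 c X, so the constant 72 c reproduces itself.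
  budget² : 0 < Δ → ∀ k → budget k * budget k ≤ 72 * c * (k * Δ)
  budget² 0<Δ = <-rec (λ k → budget k * budget k ≤ D * (k * Δ)) bound
    where
    D : ℕ
    D = 72 * c
    bound : ∀ k → (∀ {k′} → k′ < k → budget k′ * budget k′ ≤ D * (k′ * Δ)) →
      budget k * budget k ≤ D * (k * Δ)
    bound zero    _   = z≤n
    bound (suc k) rec = subst (λ s → s * s ≤ D * X) (sym (budget-suc k)) (*-cancelˡ-≤ 9 nine)
      where
      a b X : ℕ
      a = separatorBound (suc k)
      b = budget (twoThirds k)
      X = suc k * Δ
      a² : a * a ≤ 2 * c * X
      a² = ≤-trans (⌊√⌋² (c * (X + 1)))
        (subst (c * (X + 1) ≤_) (double c X) (*-monoʳ-≤ c (+-monoʳ-≤ X (*-mono-≤ (s≤s (z≤n {k})) 0<Δ))))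
        where
        double : ∀ c X → c * (X + X) ≡ 2 * c * X
        double = solve-∀
      b² : 12 * (b * b) ≤ 8 * D * X
      b² = ≤-trans (*-monoʳ-≤ 12 (rec (s≤s (twoThirds≤ k))))
        (subst₂ _≤_ (e₁ D (twoThirds k) Δ) (e₂ D k Δ) (*-monoʳ-≤ (4 * D) (*-monoˡ-≤ Δ (3*twoThirds≤ k))))
        where
        e₁ : ∀ D y Δ → 4 * D * (3 * y * Δ) ≡ 12 * (D * (y * Δ))
        e₁ = solve-∀
        e₂ : ∀ D k Δ → 4 * D * (2 * suc k * Δ) ≡ 8 * D * (suc k * Δ)
        e₂ = solve-∀
      nine : 9 * ((a + b) * (a + b)) ≤ 9 * (D * X)
      nine = ≤-trans (square-sum≤ a b)
        (subst (36 * (a * a) + 12 * (b * b) ≤_) (e c X) (+-mono-≤ (*-monoʳ-≤ 36 a²) b²))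
        where
        e : ∀ c X → 36 * (2 * c * X) + 8 * (72 * c) * X ≡ 9 * (72 * c * X)
        e = solve-∀

treeDecomposition-from-separations : ∀ G β w → β (n G) ≤ suc w →
  (∀ k U → ∣ U ∣ ≤ suc k → SeparatorRecursion.Separation G β k U) → TreewidthAtMost G w
treeDecomposition-from-separations G β w β≤ separate =
  toTreeDecomposition (weaken β≤ (decompose separate (n G) Full (∣p∣≤n Full)))
  where
  open PathDecompositions G
  open SeparatorRecursion G β

module Edgeless (G : Graph) (Δ≡0 : maxDeg G ≡ 0) where

  atMostOne : ℕ → ℕ
  atMostOne zero    = 0
  atMostOne (suc _) = 1

  open SeparatorRecursion G atMostOne

  walk-trivial : ∀ {P a b} → PWalk G P a b → a ≡ b
  walk-trivial (here _)     = refl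
  walk-trivial (step _ e _) = ⊥-elim (<-irrefl (sym Δ≡0) (edge⇒0<maxDeg G _ _ e))

  -- Without edges every component is a singleton.
  separate : ∀ k U → ∣ U ∣ ≤ suc k → Separation k U
  separate zero U size≤ = record
    { separator = U ; separator⊆ = id ; k′ = 0 ; k′≤k = z≤n
    ; components-small = λ x _ x∈ _ → ⊥-elim (x∈p─q⇒x∉q U U x∈ (p─q⊆p U U x∈))
    ; within-budget = subst (_≤ 1) (sym (+-identityʳ ∣ U ∣)) size≤ }
  separate (suc k) U size≤ = record
    { separator = Empty ; separator⊆ = ⊥-elim ∘ ∉⊥ ; k′ = 1 ; k′≤k = s≤s z≤n
    ; components-small = λ x C _ comp → subst (∣ C ∣ ≤_) (∣⁅x⁆∣≡1 x)
        (p⊆q⇒∣p∣≤∣q∣ (λ {u} u∈C → subst (_∈ ⁅ x ⁆) (walk-trivial (proj₁ (comp u) u∈C)) (x∈⁅x⁆ x)))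
    ; within-budget = subst (λ s → s + 1 ≤ 1) (sym (∣⊥∣≡0 (n G))) ≤-refl }

  treewidth-zero : TreewidthAtMost G 0
  treewidth-zero = treeDecomposition-from-separations G atMostOne 0 (atMostOne≤1 (n G)) separate
    where
    atMostOne≤1 : ∀ k → atMostOne k ≤ 1
    atMostOne≤1 zero    = z≤n
    atMostOne≤1 (suc _) = ≤-refl

module SeparableClass (𝒞 : GraphClass) (hereditary : Hereditary 𝒞) (c : ℕ)
  (separable : ∀ G → 𝒞 G → ∃ λ (S : Subset (n G)) → Balanced G S × (∣ S ∣ * ∣ S ∣ ≤ c * (edgeCount G + 1)))
  (G : Graph) (G∈𝒞 : 𝒞 G) where
  open Budget c (maxDeg G)
  open SeparatorRecursion G budget

  separate : ∀ k U → ∣ U ∣ ≤ suc k → Separation k U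
  separate k U size≤ with separable (Induced G U) (hereditary G (Induced G U) G∈𝒞 (Induced-inducedSubgraph G U))
  ... | T , balanced , T² = record
    { separator        = image U T
    ; separator⊆       = image⊆ U T
    ; k′               = twoThirds k
    ; k′≤k             = twoThirds≤ k
    ; components-small = λ x C x∈ comp →
        ≤twoThirds k ∣ C ∣ (≤-trans (balanced-image G U T balanced x C x∈ comp) (*-monoʳ-≤ 2 size≤))
    ; within-budget    = subst (∣ image U T ∣ + budget (twoThirds k) ≤_) (sym (budget-suc k))
        (+-monoˡ-≤ (budget (twoThirds k)) separator-small)
    }
    where
    separator-small : ∣ image U T ∣ ≤ separatorBound (suc k)
    separator-small = subst (_≤ separatorBound (suc k)) (sym (∣image∣ U T)) (≤⌊√⌋ ∣ T ∣ _
      (≤-trans T² (*-monoʳ-≤ c (+-monoˡ-≤ 1 (≤-trans (edgeCount-Induced G U) (*-monoˡ-≤ (maxDeg G) size≤))))))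

  treewidth-budget : TreewidthAtMost G (budget (n G))
  treewidth-budget = treeDecomposition-from-separations G budget (budget (n G)) (n≤1+n _) separate

proposition14 : (𝒞 : GraphClass) → SqrtMSeparable 𝒞 →
    ∃ λ (c : ℕ) → ∀ (G : Graph) → 𝒞 G →
      ∃ λ (w : ℕ) → TreewidthAtMost G w × (w * w ≤ c * (n G * maxDeg G))
proposition14 𝒞 (hereditary , c , separable) = 72 * c , treewidth
  where
  treewidth : ∀ G → 𝒞 G → ∃ λ w → TreewidthAtMost G w × (w * w ≤ 72 * c * (n G * maxDeg G))
  treewidth G G∈𝒞 with maxDeg G ≟ 0
  ... | yes Δ≡0 = 0 , Edgeless.treewidth-zero G Δ≡0 , z≤n
  ... | no  Δ≢0 = budget (n G) , treewidth-budget , budget² (n≢0⇒n>0 Δ≢0) (n G)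
    where
    open Budget c (maxDeg G)
    open SeparableClass 𝒞 hereditary c separable G G∈𝒞
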